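{- Let $n\ge 1$. Let $VT=\{(k,i): 0\le i\le k\le n\}$ and $E_{hor}=\{(k,i): 0<i\le k\le n\}$, with coordinates $t^k_i$ on $\mathbb{R}^{VT}$ and $h^{(k)}_i$ on $\mathbb{R}^{E_{hor}}$. Let $\mathcal{C}_2\subset\mathbb{R}^{VT}$ be the polyhedral cone defined by $$t^{k+1}_{i}+t^{k}_{i-1}\ \ge\ t^{k+1}_{i-1}+t^{k}_{i},\qquad t^{k+1}_{i}+t^{k}_{i}\ \ge\ t^{k+1}_{i+1}+t^{k}_{i-1}\qquad (0<i\le k<n),$$ let $\bar\partial:\mathbb{R}^{VT}\to\mathbb{R}^{E_{hor}}$ be the linear map $h^{(k)}_i=t^k_i-t^k_{i-1}$ ($0<i\le k\le n$), and let $\mathcal{C}_{GZ}\subset\mathbb{R}^{E_{hor}}$ be the cone defined by the interlacing inequalities $h^{(k+1)}_i\ge h^{(k)}_i\ge h^{(k+1)}_{i+1}$ for $0<i\le k<n$. Then $\mathcal{C}_{GZ}=\bar\partial(\mathcal{C}_2)$. Moreover, $\bar\partial$ restricts to an isomorphism of polyhedral cones $$\bar\partial:\ \mathcal{C}_2\cap\{t^k_0=0\ \text{for } k=0,\dots,n\}\ \longrightarrow\ \mathcal{C}_{GZ}.$$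
   Context: $VT$ indexes the nodes of the regular triangulation of a triangle into $n^2$ small triangles (row $k$ has nodes $t^k_0,\dots,t^k_k$), and $E_{hor}$ indexes its horizontal edges. The interlacing inequalities are those satisfied by the ordered eigenvalues $\lambda^{(k)}_1\ge\dots\ge\lambda^{(k)}_k$ of the upper-left $k\times k$ principal submatrices of an $n\times n$ Hermitian matrix. -}

module Defs where

open import Level using (Level; _⊔_) renaming (suc to lsuc)
open import Algebra.Bundles using (CommutativeRing)
open import Relation.Binary.Core using (Rel)
open import Relation.Binary.Structures using (IsTotalOrder)
open import Relation.Nullary using (¬_)
open import Data.Product using (∃; _×_)
open import Data.Nat using (ℕ; suc; _∸_) renaming (_≤_ to _≤ℕ_; _<_ to _<ℕ_)

-- An ordered field (the real numbers ℝ being the intended instance;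
-- agda-stdlib has no reals, so we quantify over all ordered fields).
record OrderedField (c ℓ₁ ℓ₂ : Level) : Set (lsuc (c ⊔ ℓ₁ ⊔ ℓ₂)) where
  field
    commutativeRing : CommutativeRing c ℓ₁
  open CommutativeRing commutativeRing public
  field
    _≤_         : Rel Carrier ℓ₂
    isTotalOrder : IsTotalOrder _≈_ _≤_
    +-monoˡ-≤   : ∀ {x y} z → x ≤ y → (x + z) ≤ (y + z)
    *-nonneg    : ∀ {x y} → 0# ≤ x → 0# ≤ y → 0# ≤ (x * y)
    0≉1         : ¬ (0# ≈ 1#)
    inverse     : ∀ x → ¬ (x ≈ 0#) → ∃ λ y → (x * y) ≈ 1#

  _≥_ : Rel Carrier ℓ₂
  x ≥ y = y ≤ x

module GZ {c ℓ₁ ℓ₂} (F : OrderedField c ℓ₁ ℓ₂) (n : ℕ) where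
  open OrderedField F

  -- A point of R^VT (resp. R^E_hor) is given by its coordinates t k i
  -- (resp. h k i); only values with (k,i) ∈ VT (resp. E_hor) matter.
  Coord : Set c
  Coord = ℕ → ℕ → Carrier

  C₂ : Coord → Set ℓ₂
  C₂ t = ∀ k i → 0 <ℕ i → i ≤ℕ k → k <ℕ n →
           ((t (suc k) i + t k (i ∸ 1)) ≥ (t (suc k) (i ∸ 1) + t k i))
         × ((t (suc k) i + t k i) ≥ (t (suc k) (suc i) + t k (i ∸ 1)))

  ∂̄ : Coord → Coord
  ∂̄ t k i = t k i - t k (i ∸ 1)

  C-GZ : Coord → Set ℓ₂
  C-GZ h = ∀ k i → 0 <ℕ i → i ≤ℕ k → k <ℕ n →
             (h (suc k) i ≥ h k i) × (h k i ≥ h (suc k) (suc i))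

  _≈VT_ : Coord → Coord → Set ℓ₁
  t ≈VT t' = ∀ k i → i ≤ℕ k → k ≤ℕ n → t k i ≈ t' k i

  _≈E_ : Coord → Coord → Set ℓ₁
  h ≈E h' = ∀ k i → 0 <ℕ i → i ≤ℕ k → k ≤ℕ n → h k i ≈ h' k i

  LeftZero : Coord → Set ℓ₁
  LeftZero t = ∀ k → k ≤ℕ n → t k 0 ≈ 0#

module Submission where

-- The proof is elementary linear algebra over an ordered field F.
-- (1) In an ordered abelian group, a comparison of differences is a
--     comparison of cross-sums:  a - b ≤ c - d  ⇔  a + d ≤ c + b.
--     Applied to h = ∂̄ t, this turns each of the two interlacing
--     inequalities into the corresponding defining inequality of C₂, so
--     t ∈ C₂ ⇔ ∂̄ t ∈ C_GZ.
-- (2) ∂̄ has an explicit right inverse ∫ ("integrate along each row"):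
--     (∫ h)^k_i = h^(k)_i + … + h^(k)_1, which has (∫ h)^k_0 = 0.
-- (3) A row of t is determined by its first entry and its differences, so
--     ∂̄ is injective on {t^k_0 = 0}.
-- Since C_GZ is invariant under equality of points of R^{E_hor}, (1) and (2)
-- give C_GZ = ∂̄(C₂) and surjectivity from the slice; (3) gives injectivity.

open import Defs
open import Data.Nat using (ℕ; zero; suc; _∸_; z≤n; s≤s) renaming (_≤_ to _≤ℕ_)
open import Data.Nat.Properties using (<⇒≤; m≤n⇒m≤1+n)
open import Data.Product using (∃; _×_; _,_; map)
open import Function.Bundles using (_⇔_; mk⇔; Equivalence)
open import Relation.Binary.Structures using (IsTotalOrder)
import Algebra.Properties.AbelianGroup as AbelianGroupProperties
import Algebra.Properties.CommutativeSemigroup as CommutativeSemigroupProperties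
import Relation.Binary.Reasoning.Setoid as SetoidReasoning

module OrderedGroup {c ℓ₁ ℓ₂} (F : OrderedField c ℓ₁ ℓ₂) where
  open OrderedField F
  open IsTotalOrder isTotalOrder using (≲-respˡ-≈; ≲-respʳ-≈)
  open AbelianGroupProperties +-abelianGroup
    using (//-rightDividesˡ; //-rightDividesʳ)
  open CommutativeSemigroupProperties +-commutativeSemigroup using (interchange)
  open SetoidReasoning setoid

  sub-add : ∀ x y → (x - y) + y ≈ x
  sub-add x y = //-rightDividesˡ y x

  add-sub : ∀ x y → (x + y) - y ≈ x
  add-sub x y = //-rightDividesʳ y x

  ≤-resp-≈ : ∀ {x x' y y'} → x ≈ x' → y ≈ y' → x ≤ y → x' ≤ y'
  ≤-resp-≈ x≈x' y≈y' x≤y = ≲-respʳ-≈ y≈y' (≲-respˡ-≈ x≈x' x≤y)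

  +-cancelʳ-≤ : ∀ {x y} z → (x + z) ≤ (y + z) → x ≤ y
  +-cancelʳ-≤ {x} {y} z x+z≤y+z =
    ≤-resp-≈ (add-sub x z) (add-sub y z) (+-monoˡ-≤ (- z) x+z≤y+z)

  shift-diff : ∀ x y w → (x - y) + (y + w) ≈ x + w
  shift-diff x y w = begin
    (x - y) + (y + w)   ≈⟨ interchange x (- y) y w ⟩
    (x + y) + (- y + w) ≈⟨ +-cong refl (+-comm (- y) w) ⟩
    (x + y) + (w - y)   ≈⟨ interchange x y w (- y) ⟩
    (x + w) + (y - y)   ≈⟨ +-cong refl (-‿inverseʳ y) ⟩
    (x + w) + 0#        ≈⟨ +-identityʳ (x + w) ⟩
    x + w               ∎

  diff-≤-diff : ∀ a b c d → ((a - b) ≤ (c - d)) ⇔ ((a + d) ≤ (c + b))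
  diff-≤-diff a b c d = mk⇔
    (λ a-b≤c-d → ≤-resp-≈ (shift-diff a b d) (shift-c-d)
                           (+-monoˡ-≤ (b + d) a-b≤c-d))
    (λ a+d≤c+b → +-cancelʳ-≤ (b + d)
                   (≤-resp-≈ (sym (shift-diff a b d)) (sym shift-c-d) a+d≤c+b))
    where
    shift-c-d : (c - d) + (b + d) ≈ c + b
    shift-c-d = trans (+-cong refl (+-comm b d)) (shift-diff c d b)

module Cones {c ℓ₁ ℓ₂} (F : OrderedField c ℓ₁ ℓ₂) (n : ℕ) where
  open OrderedField F
  open GZ F n
  open OrderedGroup F

  -- (1) The two interlacing inequalities for ∂̄ t at (k, i) are exactly the
  -- two inequalities defining C₂ at (k, i), by diff-≤-diff and commuting
  -- the summands on one side.
  C₂⇔C-GZ∘∂̄ : ∀ t → C₂ t ⇔ C-GZ (∂̄ t)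
  C₂⇔C-GZ∘∂̄ t = mk⇔
    (λ t∈C₂ k i 0<i i≤k k<n →
       map (Equivalence.from (upper-rung k i)) (Equivalence.from (lower-rung k i))
           (t∈C₂ k i 0<i i≤k k<n))
    (λ ∂̄t∈GZ k i 0<i i≤k k<n →
       map (Equivalence.to (upper-rung k i)) (Equivalence.to (lower-rung k i))
           (∂̄t∈GZ k i 0<i i≤k k<n))
    where
    upper-rung : ∀ k i →
      (∂̄ t (suc k) i ≥ ∂̄ t k i)
        ⇔ ((t (suc k) i + t k (i ∸ 1)) ≥ (t (suc k) (i ∸ 1) + t k i))
    upper-rung k i = mk⇔
      (λ ineq → ≤-resp-≈ (+-comm _ _) refl
                  (Equivalence.to (diff-≤-diff _ _ _ _) ineq))
      (λ ineq → Equivalence.from (diff-≤-diff _ _ _ _)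
                  (≤-resp-≈ (+-comm _ _) refl ineq))

    lower-rung : ∀ k i →
      (∂̄ t k i ≥ ∂̄ t (suc k) (suc i))
        ⇔ ((t (suc k) i + t k i) ≥ (t (suc k) (suc i) + t k (i ∸ 1)))
    lower-rung k i = mk⇔
      (λ ineq → ≤-resp-≈ refl (+-comm _ _)
                  (Equivalence.to (diff-≤-diff _ _ _ _) ineq))
      (λ ineq → Equivalence.from (diff-≤-diff _ _ _ _)
                  (≤-resp-≈ refl (+-comm _ _) ineq))

  C-GZ-resp-≈E : ∀ {h h'} → h ≈E h' → C-GZ h → C-GZ h'
  C-GZ-resp-≈E {h} {h'} h≈h' h∈GZ k i 0<i i≤k k<n =
    map (≤-resp-≈ same-k next-k) (≤-resp-≈ next-ki same-k) (h∈GZ k i 0<i i≤k k<n)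
    where
    same-k : h k i ≈ h' k i
    same-k = h≈h' k i 0<i i≤k (<⇒≤ k<n)
    next-k : h (suc k) i ≈ h' (suc k) i
    next-k = h≈h' (suc k) i 0<i (m≤n⇒m≤1+n i≤k) k<n
    next-ki : h (suc k) (suc i) ≈ h' (suc k) (suc i)
    next-ki = h≈h' (suc k) (suc i) (s≤s z≤n) (s≤s i≤k) k<n

  sym-≈E : ∀ {h h'} → h ≈E h' → h' ≈E h
  sym-≈E h≈h' k i 0<i i≤k k≤n = sym (h≈h' k i 0<i i≤k k≤n)

  ∫ : Coord → Coord
  ∫ h k zero    = 0#
  ∫ h k (suc i) = h k (suc i) + ∫ h k i

  ∫-LeftZero : ∀ h → LeftZero (∫ h)
  ∫-LeftZero h k _ = refl

  ∂̄∘∫ : ∀ h → ∂̄ (∫ h) ≈E h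
  ∂̄∘∫ h k (suc i) _ _ _ = add-sub (h k (suc i)) (∫ h k i)

  ∫-lifts-C-GZ : ∀ h → C-GZ h → C₂ (∫ h)
  ∫-lifts-C-GZ h h∈GZ =
    Equivalence.from (C₂⇔C-GZ∘∂̄ (∫ h)) (C-GZ-resp-≈E (sym-≈E (∂̄∘∫ h)) h∈GZ)

  -- (3) On the slice {t^k_0 = 0}, each row is recovered from its
  -- differences by induction along the row: t^k_{i+1} = h^(k)_{i+1} + t^k_i.
  ∂̄-injective-on-LeftZero : ∀ t t' → LeftZero t → LeftZero t' →
                            ∂̄ t ≈E ∂̄ t' → t ≈VT t'
  ∂̄-injective-on-LeftZero t t' t₀≈0 t'₀≈0 ∂̄t≈∂̄t' k zero _ k≤n =
    trans (t₀≈0 k k≤n) (sym (t'₀≈0 k k≤n))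
  ∂̄-injective-on-LeftZero t t' t₀≈0 t'₀≈0 ∂̄t≈∂̄t' k (suc i) i<k k≤n = begin
    t k (suc i)                          ≈⟨ sub-add (t k (suc i)) (t k i) ⟨
    (t k (suc i) - t k i) + t k i        ≈⟨ +-cong (∂̄t≈∂̄t' k (suc i) (s≤s z≤n) i<k k≤n)
                                                   (∂̄-injective-on-LeftZero t t' t₀≈0 t'₀≈0
                                                      ∂̄t≈∂̄t' k i (<⇒≤ i<k) k≤n) ⟩
    (t' k (suc i) - t' k i) + t' k i     ≈⟨ sub-add (t' k (suc i)) (t' k i) ⟩
    t' k (suc i)                         ∎
    where open SetoidReasoning setoid

proposition2p2 : ∀ {c ℓ₁ ℓ₂} (F : OrderedField c ℓ₁ ℓ₂) (n : ℕ) → 1 ≤ℕ n →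
    let open GZ F n in
      (∀ h → C-GZ h ⇔ (∃ λ t → C₂ t × (∂̄ t ≈E h)))
    × (∀ t t' → C₂ t → LeftZero t → C₂ t' → LeftZero t' → ∂̄ t ≈E ∂̄ t' → t ≈VT t')
    × (∀ h → C-GZ h → ∃ λ t → C₂ t × LeftZero t × (∂̄ t ≈E h))
proposition2p2 F n _ = image , injective , lift-to-slice
  where
  open GZ F n
  open Cones F n

  lift-to-slice : ∀ h → C-GZ h → ∃ λ t → C₂ t × LeftZero t × (∂̄ t ≈E h)
  lift-to-slice h h∈GZ = ∫ h , ∫-lifts-C-GZ h h∈GZ , ∫-LeftZero h , ∂̄∘∫ h

  image : ∀ h → C-GZ h ⇔ (∃ λ t → C₂ t × (∂̄ t ≈E h))
  image h = mk⇔
    (λ h∈GZ → ∫ h , ∫-lifts-C-GZ h h∈GZ , ∂̄∘∫ h)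
    (λ { (t , t∈C₂ , ∂̄t≈h) →
           C-GZ-resp-≈E ∂̄t≈h (Equivalence.to (C₂⇔C-GZ∘∂̄ t) t∈C₂) })

  injective : ∀ t t' → C₂ t → LeftZero t → C₂ t' → LeftZero t' →
              ∂̄ t ≈E ∂̄ t' → t ≈VT t'
  injective t t' _ t₀≈0 _ t'₀≈0 = ∂̄-injective-on-LeftZero t t' t₀≈0 t'₀≈0
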